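{- Let $k, d, q, \tau \in \mathbb{N}$ satisfy $k,q\ge 2$ and $d \ge \tau \ge 2k \log q$. Let $v \in V(T_{k,d})$ have depth at most $d-\tau$ and let $A \subseteq L(T_{k,d})$ satisfy $\mathsf{Frac}_A(v) \ge \frac 1 q$. Then there exists a vertex $u \in V(T^{v,\tau}_{k,d})$ such that every $y \in \mathsf{Children}(u)$ satisfies $\mathsf{Frac}_A(y) \ge \frac 1 {2q}$.
   Context: $\log$ denotes the base-2 logarithm. $T_{k,d}$ is the full $k$-ary rooted tree of depth $d$ (root of depth $0$, where depth is the number of edges from the root; $k^d$ leaves at depth $d$). $L(T)$ is the set of leaves of a rooted tree $T$, $T^v_{k,d}$ is the subtree rooted at $v$, and $\mathsf{Children}(v)$ is the set of children of $v$. For $\ell\ge1$, $T^{v,\ell}_{k,d}$ is the tree formed by the first $\ell$ layers of $T^v_{k,d}$, i.e. the descendants of $v$ (including $v$) at distance at most $\ell-1$ from $v$. For $A\subseteq L(T_{k,d})$ and a vertex $v$, $\mathsf{Frac}_A(v)=|A\cap L(T^v_{k,d})|/|L(T^v_{k,d})|$. -}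

module Defs where

open import Data.Nat using (ℕ; zero; suc; _+_; _*_)
open import Data.Fin using (Fin)
open import Data.Fin.Properties using (_≟_)
open import Data.Bool using (Bool; true; false; _∧_; if_then_else_)
open import Data.List using (List; []; _∷_)
open import Data.Vec using (Vec; []; _∷_)
open import Relation.Nullary.Decidable using (⌊_⌋)

-- Vertices of T_{k,d}: root-to-vertex paths, i.e. lists over Fin k of length ≤ d
-- (depth = length).  Leaves of T_{k,d}: paths of length exactly d, i.e. Vec (Fin k) d.
-- Children of u : the lists u ++ [ i ] for i : Fin k.

sumFin : (k : ℕ) → (Fin k → ℕ) → ℕ
sumFin zero    f = 0
sumFin (suc k) f = f Fin.zero + sumFin k (λ i → f (Fin.suc i))

count : (k n : ℕ) → (Vec (Fin k) n → Bool) → ℕ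
count k zero    p = if p [] then 1 else 0
count k (suc n) p = sumFin k (λ i → count k n (λ w → p (i ∷ w)))

-- isPrefix v ℓ = true  iff  the vertex v is an ancestor-or-equal of the leaf ℓ,
-- i.e. ℓ ∈ L(T^v_{k,d}).
isPrefix : {k n : ℕ} → List (Fin k) → Vec (Fin k) n → Bool
isPrefix []      _       = true
isPrefix (_ ∷ _) []      = false
isPrefix (a ∷ v) (b ∷ w) = ⌊ a ≟ b ⌋ ∧ isPrefix v w

leafCount : (k d : ℕ) → List (Fin k) → ℕ
leafCount k d v = count k d (λ ℓ → isPrefix v ℓ)

hitCount : (k d : ℕ) → (Vec (Fin k) d → Bool) → List (Fin k) → ℕ
hitCount k d A v = count k d (λ ℓ → isPrefix v ℓ ∧ A ℓ)

-- Frac_A(v) ≥ 1/m   ⇔   |L(T^v)| ≤ m · |A ∩ L(T^v)|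
FracAtLeastInv : (k d : ℕ) → (Vec (Fin k) d → Bool) → List (Fin k) → ℕ → Set
FracAtLeastInv k d A v m = leafCount k d v Data.Nat.≤ m * hitCount k d A v

-- Maintain the invariant Frac(u) ≥ (1 + r)/c at the current vertex u, with c = 2q and
-- initially r = 1.  If some child of u has density below 1/c, the other k - 1 children carry
-- the rest of u's leaves, so the densest child has density at least (1 + r k/(k-1))/c:
-- descending to it multiplies r by k/(k-1).  Bernoulli's inequality gives
-- (k/(k-1))^(k-1) ≥ 2, so (k/(k-1))^τ ≥ 2^(τ/(k-1)) ≥ c once (2q)^(k-1) ≤ q^(2k) ≤ 2^τ;
-- since r ≥ c would force density above 1, fewer than τ descents are possible.
module Submission where

open import Defs
open import Data.Nat using (ℕ; zero; suc; _+_; _*_; _^_; _≤_; _<_; z≤n; s≤s; _≤?_; NonZero)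
open import Data.Nat.Properties hiding (_≟_)
open import Data.Nat.Tactic.RingSolver using (solve-∀)
open import Algebra.Properties.CommutativeSemigroup *-commutativeSemigroup
  using () renaming (interchange to *-interchange)
open import Data.Fin using (Fin; zero; suc)
open import Data.Fin.Properties using (_≟_; all?; ¬∀⟶∃¬)
open import Data.Bool using (Bool; true; false; _∧_; if_then_else_)
open import Data.Bool.Properties using (∧-assoc)
open import Data.List using (List; []; _∷_; length; _++_; [_])
open import Data.Vec using (Vec; []; _∷_)
open import Data.Product using (Σ; _×_; _,_)
open import Function.Base using (id)
open import Function.Bundles using (_⇔_; mk⇔; Equivalence)
open import Relation.Nullary using (¬_; yes; no; contradiction)
open import Relation.Nullary.Decidable using (⌊_⌋)
open import Relation.Binary.PropositionalEquality hiding ([_])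

open Equivalence using (to; from)

^-distribʳ-* : ∀ m n o → (m * n) ^ o ≡ m ^ o * n ^ o
^-distribʳ-* m n zero    = refl
^-distribʳ-* m n (suc o) =
  trans (cong (m * n *_) (^-distribʳ-* m n o)) (*-interchange m n (m ^ o) (n ^ o))

^-swap : ∀ x m n → (x ^ m) ^ n ≡ (x ^ n) ^ m
^-swap x m n = begin
  (x ^ m) ^ n   ≡⟨ ^-*-assoc x m n ⟩
  x ^ (m * n)   ≡⟨ cong (x ^_) (*-comm m n) ⟩
  x ^ (n * m)   ≡⟨ ^-*-assoc x n m ⟨
  (x ^ n) ^ m   ∎
  where open ≡-Reasoning

^-cancelˡ-≤ : ∀ e .{{_ : NonZero e}} {x y} → x ^ e ≤ y ^ e → x ≤ y
^-cancelˡ-≤ e {x} {y} xᵉ≤yᵉ with x ≤? y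
... | yes x≤y = x≤y
... | no  x≰y = contradiction xᵉ≤yᵉ (<⇒≱ (^-monoˡ-< e (≰⇒> x≰y)))

-- Bernoulli's inequality (1 + 1/n)^m ≥ 1 + m/n, multiplied by n^(m+1).
bernoulli : ∀ n m → n ^ m * (n + m) ≤ n * suc n ^ m
bernoulli n zero    = ≤-reflexive (base n)
  where
  base : ∀ n → 1 * (n + 0) ≡ n * 1
  base = solve-∀
bernoulli n (suc m) = begin
  n * n ^ m * (n + suc m)             ≤⟨ m≤m+n _ (n ^ m * m) ⟩
  n * n ^ m * (n + suc m) + n ^ m * m ≡⟨ regroup n m (n ^ m) ⟩
  suc n * (n ^ m * (n + m))           ≤⟨ *-monoʳ-≤ (suc n) (bernoulli n m) ⟩
  suc n * (n * suc n ^ m)             ≡⟨ x*[y*z]≡y*[x*z] (suc n) n (suc n ^ m) ⟩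
  n * (suc n * suc n ^ m)             ∎
  where
  open ≤-Reasoning
  regroup : ∀ n m x → n * x * (n + (1 + m)) + x * m ≡ (1 + n) * (x * (n + m))
  regroup = solve-∀
  x*[y*z]≡y*[x*z] : ∀ x y z → x * (y * z) ≡ y * (x * z)
  x*[y*z]≡y*[x*z] = solve-∀

2*n^n≤[1+n]^n : ∀ n .{{_ : NonZero n}} → 2 * n ^ n ≤ suc n ^ n
2*n^n≤[1+n]^n n = *-cancelˡ-≤ n (begin
  n * (2 * n ^ n)   ≡⟨ regroup n (n ^ n) ⟩
  n ^ n * (n + n)   ≤⟨ bernoulli n n ⟩
  n * suc n ^ n     ∎)
  where
  open ≤-Reasoning
  regroup : ∀ n x → n * (2 * x) ≡ x * (n + n)
  regroup = solve-∀

c*n^τ≤[1+n]^τ : ∀ n .{{_ : NonZero n}} c τ → c ^ n ≤ 2 ^ τ → c * n ^ τ ≤ suc n ^ τ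
c*n^τ≤[1+n]^τ n c τ cⁿ≤2^τ = ^-cancelˡ-≤ n (begin
  (c * n ^ τ) ^ n      ≡⟨ ^-distribʳ-* c (n ^ τ) n ⟩
  c ^ n * (n ^ τ) ^ n  ≤⟨ *-monoˡ-≤ _ cⁿ≤2^τ ⟩
  2 ^ τ * (n ^ τ) ^ n  ≡⟨ cong (2 ^ τ *_) (^-swap n τ n) ⟩
  2 ^ τ * (n ^ n) ^ τ  ≡⟨ ^-distribʳ-* 2 (n ^ n) τ ⟨
  (2 * n ^ n) ^ τ      ≤⟨ ^-monoˡ-≤ τ (2*n^n≤[1+n]^n n) ⟩
  (suc n ^ n) ^ τ      ≡⟨ ^-swap (suc n) n τ ⟩
  (suc n ^ τ) ^ n      ∎)
  where open ≤-Reasoning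

[2q]^n≤q^[2+2n] : ∀ q n → 2 ≤ q → (2 * q) ^ n ≤ q ^ (2 * suc n)
[2q]^n≤q^[2+2n] q@(suc _) n 2≤q = begin
  (2 * q) ^ n      ≤⟨ ^-monoˡ-≤ n 2q≤q² ⟩
  (q ^ 2) ^ n      ≤⟨ ^-monoʳ-≤ (q ^ 2) (n≤1+n n) ⟩
  (q ^ 2) ^ suc n  ≡⟨ ^-*-assoc q 2 (suc n) ⟩
  q ^ (2 * suc n)  ∎
  where
  open ≤-Reasoning
  2q≤q² : 2 * q ≤ q ^ 2
  2q≤q² = subst (2 * q ≤_) (cong (q *_) (sym (*-identityʳ q))) (*-monoˡ-≤ q 2≤q)

sumFin-cong : ∀ n {f g : Fin n → ℕ} → (∀ i → f i ≡ g i) → sumFin n f ≡ sumFin n g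
sumFin-cong zero    f≡g = refl
sumFin-cong (suc n) f≡g = cong₂ _+_ (f≡g zero) (sumFin-cong n (λ i → f≡g (suc i)))

sumFin-mono : ∀ n {f g : Fin n → ℕ} → (∀ i → f i ≤ g i) → sumFin n f ≤ sumFin n g
sumFin-mono zero    f≤g = z≤n
sumFin-mono (suc n) f≤g = +-mono-≤ (f≤g zero) (sumFin-mono n (λ i → f≤g (suc i)))

sumFin-const : ∀ n c → sumFin n (λ _ → c) ≡ n * c
sumFin-const zero    c = refl
sumFin-const (suc n) c = cong (c +_) (sumFin-const n c)

sumFin-zero : ∀ n → sumFin n (λ _ → 0) ≡ 0
sumFin-zero n = trans (sumFin-const n 0) (*-zeroʳ n)

sumFin-≤ : ∀ n {f : Fin n → ℕ} {M} → (∀ i → f i ≤ M) → sumFin n f ≤ n * M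
sumFin-≤ n {M = M} f≤M = ≤-trans (sumFin-mono n f≤M) (≤-reflexive (sumFin-const n M))

sumFin-≤-pick : ∀ n {f : Fin (suc n) → ℕ} {M} j → (∀ i → f i ≤ M) → sumFin (suc n) f ≤ f j + n * M
sumFin-≤-pick n       {f} zero    f≤M = +-monoʳ-≤ (f zero) (sumFin-≤ n (λ i → f≤M (suc i)))
sumFin-≤-pick (suc n) {f} {M} (suc j) f≤M = begin
  f zero + sumFin (suc n) (λ i → f (suc i))
    ≤⟨ +-mono-≤ (f≤M zero) (sumFin-≤-pick n j (λ i → f≤M (suc i))) ⟩
  M + (f (suc j) + n * M)                    ≡⟨ x+[y+z]≡y+[x+z] M (f (suc j)) (n * M) ⟩
  f (suc j) + (M + n * M)                    ∎
  where
  open ≤-Reasoning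
  x+[y+z]≡y+[x+z] : ∀ x y z → x + (y + z) ≡ y + (x + z)
  x+[y+z]≡y+[x+z] = solve-∀

≟-suc : ∀ {n} (a i : Fin n) → ⌊ suc a ≟ suc i ⌋ ≡ ⌊ a ≟ i ⌋
≟-suc a i with a ≟ i
... | yes _ = refl
... | no  _ = refl

sumFin-select : ∀ n (a : Fin n) (f : Fin n → ℕ) →
                sumFin n (λ i → if ⌊ a ≟ i ⌋ then f i else 0) ≡ f a
sumFin-select (suc n) zero    f = trans (cong (f zero +_) (sumFin-zero n)) (+-identityʳ (f zero))
sumFin-select (suc n) (suc a) f = trans
  (sumFin-cong n (λ i → cong (if_then f (suc i) else 0) (≟-suc a i)))
  (sumFin-select n a (λ i → f (suc i)))

argmax : ∀ n (f : Fin (suc n) → ℕ) → Σ (Fin (suc n)) λ m → ∀ i → f i ≤ f m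
argmax zero    f = zero , λ { zero → ≤-refl }
argmax (suc n) f with argmax n (λ i → f (suc i))
... | m , f≤fm with f zero ≤? f (suc m)
...   | yes f0≤fm = suc m , λ { zero → f0≤fm ; (suc i) → f≤fm i }
...   | no  f0≰fm = zero  , λ { zero → ≤-refl ; (suc i) → ≤-trans (f≤fm i) (<⇒≤ (≰⇒> f0≰fm)) }

count-cong : ∀ k n {P Q : Vec (Fin k) n → Bool} → (∀ w → P w ≡ Q w) → count k n P ≡ count k n Q
count-cong k zero    P≡Q rewrite P≡Q [] = refl
count-cong k (suc n) P≡Q = sumFin-cong k (λ i → count-cong k n (λ w → P≡Q (i ∷ w)))

count-false : ∀ k n → count k n (λ _ → false) ≡ 0
count-false k zero    = refl
count-false k (suc n) = trans (sumFin-cong k (λ _ → count-false k n)) (sumFin-zero k)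

count-true : ∀ k n → count k n (λ _ → true) ≡ k ^ n
count-true k zero    = refl
count-true k (suc n) = trans (sumFin-cong k (λ _ → count-true k n)) (sumFin-const k (k ^ n))

count-≤ : ∀ k n (P : Vec (Fin k) n → Bool) → count k n P ≤ k ^ n
count-≤ k zero    P with P []
... | true  = ≤-refl
... | false = z≤n
count-≤ k (suc n) P = sumFin-≤ k (λ i → count-≤ k n (λ w → P (i ∷ w)))

count-∧ˡ : ∀ k n b (P : Vec (Fin k) n → Bool) →
           count k n (λ w → b ∧ P w) ≡ (if b then count k n P else 0)
count-∧ˡ k n true  P = refl
count-∧ˡ k n false P = count-false k n

count-first : ∀ k n (a : Fin k) (P : Fin k → Vec (Fin k) n → Bool) →
              sumFin k (λ i → count k n (λ w → ⌊ a ≟ i ⌋ ∧ P i w)) ≡ count k n (P a)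
count-first k n a P = trans
  (sumFin-cong k (λ i → count-∧ˡ k n ⌊ a ≟ i ⌋ (P i)))
  (sumFin-select k a (λ i → count k n (P i)))

restrict : ∀ {k d} → (Vec (Fin k) (suc d) → Bool) → Fin k → Vec (Fin k) d → Bool
restrict A a w = A (a ∷ w)

leafCount-∷ : ∀ k d (a : Fin k) u → leafCount k (suc d) (a ∷ u) ≡ leafCount k d u
leafCount-∷ k d a u = count-first k d a (λ _ → isPrefix u)

hitCount-∷ : ∀ k d A (a : Fin k) u → hitCount k (suc d) A (a ∷ u) ≡ hitCount k d (restrict A a) u
hitCount-∷ k d A a u = trans
  (sumFin-cong k (λ i → count-cong k d (λ w → ∧-assoc ⌊ a ≟ i ⌋ (isPrefix u w) (A (i ∷ w)))))
  (count-first k d a (λ i w → isPrefix u w ∧ A (i ∷ w)))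

frac-∷ : ∀ k d A (a : Fin k) u m →
         FracAtLeastInv k (suc d) A (a ∷ u) m ⇔ FracAtLeastInv k d (restrict A a) u m
frac-∷ k d A a u m rewrite leafCount-∷ k d a u | hitCount-∷ k d A a u = mk⇔ id id

frac-root : ∀ k d A m → FracAtLeastInv k d A [] m ⇔ k ^ d ≤ m * count k d A
frac-root k d A m rewrite count-true k d = mk⇔ id id

frac-child : ∀ k d A (i : Fin k) m →
             FracAtLeastInv k (suc d) A [ i ] m ⇔ k ^ d ≤ m * count k d (restrict A i)
frac-child k d A i m = mk⇔
  (λ dense → to (frac-root k d (restrict A i) m) (to (frac-∷ k d A i [] m) dense))
  (λ dense → from (frac-∷ k d A i [] m) (from (frac-root k d (restrict A i) m) dense))

GoodDescendant : (k d : ℕ) → (Vec (Fin k) d → Bool) → List (Fin k) → ℕ → ℕ → Set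
GoodDescendant k d A v τ c =
  Σ (List (Fin k)) λ w → (length w < τ) × ((i : Fin k) → FracAtLeastInv k d A (v ++ w ++ [ i ]) c)

-- The subtree below a vertex is again a full k-ary tree.
goodDescendant-anywhere : ∀ {k τ p c} →
  (∀ {d} A → τ ≤ d → FracAtLeastInv k d A [] p → GoodDescendant k d A [] τ c) →
  ∀ {d} A v → length v + τ ≤ d → FracAtLeastInv k d A v p → GoodDescendant k d A v τ c
goodDescendant-anywhere atRoot A []      τ≤d     dense = atRoot A τ≤d dense
goodDescendant-anywhere {k} {p = p} {c} atRoot {suc d} A (a ∷ v) (s≤s |v|+τ≤d) dense
  with goodDescendant-anywhere {p = p} {c} atRoot (restrict A a) v |v|+τ≤d (to (frac-∷ k d A a v p) dense)
... | w , |w|<τ , good = w , |w|<τ , λ i → from (frac-∷ k d A a (v ++ w ++ [ i ]) c) (good i)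

density-exceeds-one : ∀ {P H a b c} → c * b ≤ a → 1 ≤ b → 1 ≤ P → H ≤ P →
                      ¬ (P * (a + b) ≤ c * H * b)
density-exceeds-one {P} {H} {a} {b} {c} cb≤a 1≤b 1≤P H≤P dense =
  <⇒≱ (*-mono-≤ 1≤P 1≤b) (+-cancelˡ-≤ (P * a) (P * b) 0 (begin
    P * a + P * b  ≡⟨ *-distribˡ-+ P a b ⟨
    P * (a + b)    ≤⟨ dense ⟩
    c * H * b      ≤⟨ *-monoˡ-≤ b (*-monoʳ-≤ c H≤P) ⟩
    c * P * b      ≡⟨ regroup c P b ⟩
    P * (c * b)    ≤⟨ *-monoʳ-≤ P cb≤a ⟩
    P * a          ≡⟨ +-identityʳ (P * a) ⟨
    P * a + 0      ∎))
  where
  open ≤-Reasoning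
  regroup : ∀ c P b → c * P * b ≡ P * (c * b)
  regroup = solve-∀

densest-child : ∀ n c a b {P H Hj Hm} → H ≤ Hj + n * Hm → c * Hj ≤ P →
  suc n * P * (a + b) ≤ c * H * b → P * (a * suc n + b * n) ≤ c * Hm * (b * n)
densest-child n c a b {P} {H} {Hj} {Hm} H≤Hj+nHm sparse dense =
  +-cancelʳ-≤ (b * P) _ _ (begin
    P * (a * suc n + b * n) + b * P   ≡⟨ regroupˡ P a b n ⟩
    suc n * P * (a + b)               ≤⟨ dense ⟩
    c * H * b                         ≤⟨ *-monoˡ-≤ b (*-monoʳ-≤ c H≤Hj+nHm) ⟩
    c * (Hj + n * Hm) * b             ≡⟨ regroupʳ c Hj n Hm b ⟩
    b * (c * Hj) + c * Hm * (b * n)   ≤⟨ +-monoˡ-≤ _ (*-monoʳ-≤ b sparse) ⟩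
    b * P + c * Hm * (b * n)          ≡⟨ +-comm (b * P) _ ⟩
    c * Hm * (b * n) + b * P          ∎)
  where
  open ≤-Reasoning
  regroupˡ : ∀ P a b n → P * (a * (1 + n) + b * n) + b * P ≡ (1 + n) * P * (a + b)
  regroupˡ = solve-∀
  regroupʳ : ∀ c Hj n Hm b → c * (Hj + n * Hm) * b ≡ b * (c * Hj) + c * Hm * (b * n)
  regroupʳ = solve-∀

-- Invariant: Frac_B(root) ≥ (1 + a/b)/c.
descend : ∀ n c t d a b (B : Vec (Fin (suc n)) d → Bool) → 1 ≤ n → t ≤ d → 1 ≤ b →
  c * b * n ^ t ≤ a * suc n ^ t →
  suc n ^ d * (a + b) ≤ c * count (suc n) d B * b →
  GoodDescendant (suc n) d B [] t c
descend n c zero d a b B _ _ 1≤b growth dense =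
  contradiction dense (density-exceeds-one {c = c} cb≤a 1≤b (m^n>0 (suc n) d) (count-≤ _ d B))
  where
  cb≤a : c * b ≤ a
  cb≤a = subst₂ _≤_ (*-identityʳ (c * b)) (*-identityʳ a) growth
descend n c (suc t) (suc d) a b B 1≤n (s≤s t≤d) 1≤b growth dense
  with all? (λ i → suc n ^ d ≤? c * count (suc n) d (restrict B i))
... | yes allDense = [] , s≤s z≤n , λ i → from (frac-child (suc n) d B i c) (allDense i)
... | no notAllDense
  with ¬∀⟶∃¬ (suc n) _ (λ i → suc n ^ d ≤? c * count (suc n) d (restrict B i)) notAllDense
     | argmax n (λ i → count (suc n) d (restrict B i))
... | j , sparse | m , densest
  with descend n c t d (a * suc n) (b * n) (restrict B m) 1≤n t≤d (*-mono-≤ 1≤b 1≤n) growth′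
         (densest-child n c a b (sumFin-≤-pick n j densest) (<⇒≤ (≰⇒> sparse)) dense)
  where
  growth′ : c * (b * n) * n ^ t ≤ a * suc n * suc n ^ t
  growth′ = subst₂ _≤_ (regroup c b n (n ^ t)) (sym (*-assoc a (suc n) (suc n ^ t))) growth
    where
    regroup : ∀ c b n x → c * b * (n * x) ≡ c * (b * n) * x
    regroup = solve-∀
... | w , |w|<t , good = m ∷ w , s≤s |w|<t , λ i → from (frac-∷ (suc n) d B m (w ++ [ i ]) c) (good i)

lemma13 : (k d q τ : ℕ) → 2 ≤ k → 2 ≤ q → τ ≤ d → q ^ (2 * k) ≤ 2 ^ τ → 2 ≤ τ →
    (v : List (Fin k)) → length v + τ ≤ d →
    (A : Vec (Fin k) d → Bool) → FracAtLeastInv k d A v q →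
    Σ (List (Fin k)) λ w → (length w < τ) ×
    ((i : Fin k) → FracAtLeastInv k d A (v ++ w ++ [ i ]) (2 * q))
lemma13 (suc zero) _ _ _ (s≤s ())
lemma13 (suc (suc n)) d q τ _ 2≤q _ q^2k≤2^τ _ v |v|+τ≤d A dense =
  goodDescendant-anywhere {p = q} {2 * q} atRoot A v |v|+τ≤d dense
  where
  k = suc (suc n)
  growth : 2 * q * 1 * suc n ^ τ ≤ 1 * k ^ τ
  growth = subst₂ _≤_ (cong (_* suc n ^ τ) (sym (*-identityʳ (2 * q)))) (sym (*-identityˡ (k ^ τ)))
    (c*n^τ≤[1+n]^τ (suc n) (2 * q) τ (≤-trans ([2q]^n≤q^[2+2n] q (suc n) 2≤q) q^2k≤2^τ))
  double : ∀ {x h} → x ≤ q * h → x * (1 + 1) ≤ 2 * q * h * 1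
  double {x} {h} x≤qh = subst₂ _≤_ (regroupˡ x) (regroupʳ q h) (+-mono-≤ x≤qh x≤qh)
    where
    regroupˡ : ∀ x → x + x ≡ x * (1 + 1)
    regroupˡ = solve-∀
    regroupʳ : ∀ q h → q * h + q * h ≡ 2 * q * h * 1
    regroupʳ = solve-∀
  atRoot : ∀ {d} A → τ ≤ d → FracAtLeastInv k d A [] q → GoodDescendant k d A [] τ (2 * q)
  atRoot {d} A τ≤d dense =
    descend (suc n) (2 * q) τ d 1 1 A (s≤s z≤n) τ≤d ≤-refl growth (double (to (frac-root k d A q) dense))
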